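{- Let $\mathcal M=(M,\mathcal S)$ be a model of $\mathsf{RCA}_0+\mathsf{I}\Sigma^0_2$, let $\Psi$ be a $\Sigma^0_1$ partial function $M^2\to M$, and let $B\subseteq M$ be $\Sigma^0_2$. Then the family $\{\Psi_e : e\in B \text{ and } \Psi_e \text{ is total}\}$ is weakly represented.
   Context: A $\Sigma^0_n$ / $\Pi^0_n$ formula or set is one that is $\Sigma_n$ / $\Pi_n$ using finitely many set parameters from $\mathcal S$. $\mathsf{I}\Sigma^0_2$ is induction for $\Sigma^0_2$ formulas. For a partial function $\Psi: M^2\to M$ with $\Sigma^0_1$ graph, $\Psi_e(x)=\Psi(e,x)$. A family $\mathcal F$ of total functions $M\to M$ is weakly represented if there is a $\Sigma^0_1$ partial function $\Theta:M^2\to M$ with $\mathcal F=\{\Theta_e : \Theta_e \text{ is total}\}$. -}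

module Defs where

open import Level using (0ℓ)
open import Data.Nat using (ℕ; zero; suc)
open import Data.Fin using (Fin; zero; suc)
open import Data.Product using (Σ; _×_; _,_; ∃)
open import Data.Sum using (_⊎_)
open import Relation.Nullary using (¬_)
open import Relation.Binary.PropositionalEquality using (_≡_)
open import Data.Vec.Functional using (Vector; _∷_; [])
open import Function.Bundles using (_⇔_)

-- Fm k n : formulas with k free set variables and n free
-- number variables (de Bruijn).

infix 7 _`+_ _`*_
data Tm (n : ℕ) : Set where
  var : Fin n → Tm n
  `0 `1 : Tm n
  _`+_ _`*_ : Tm n → Tm n → Tm n

data Fm (k n : ℕ) : Set where
  _`=_ _`<_ : Tm n → Tm n → Fm k n
  _`∈_ : Tm n → Fin k → Fm k n
  `¬ : Fm k n → Fm k n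
  _`∧_ _`∨_ _`⇒_ : Fm k n → Fm k n → Fm k n
  `∀ `∃ : Fm k (suc n) → Fm k n
  `∀< `∃< : Tm n → Fm k (suc n) → Fm k n

data Bounded {k : ℕ} : {n : ℕ} → Fm k n → Set where
  b= : ∀ {n} (s t : Tm n) → Bounded (s `= t)
  b< : ∀ {n} (s t : Tm n) → Bounded (s `< t)
  b∈ : ∀ {n} (t : Tm n) (X : Fin k) → Bounded (t `∈ X)
  b¬ : ∀ {n} {φ : Fm k n} → Bounded φ → Bounded (`¬ φ)
  b∧ : ∀ {n} {φ ψ : Fm k n} → Bounded φ → Bounded ψ → Bounded (φ `∧ ψ)
  b∨ : ∀ {n} {φ ψ : Fm k n} → Bounded φ → Bounded ψ → Bounded (φ `∨ ψ)
  b⇒ : ∀ {n} {φ ψ : Fm k n} → Bounded φ → Bounded ψ → Bounded (φ `⇒ ψ)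
  b∀< : ∀ {n} (t : Tm n) {φ : Fm k (suc n)} → Bounded φ → Bounded (`∀< t φ)
  b∃< : ∀ {n} (t : Tm n) {φ : Fm k (suc n)} → Bounded φ → Bounded (`∃< t φ)

mutual
  data IsΣ {k : ℕ} : ℕ → {n : ℕ} → Fm k n → Set where
    σ₀ : ∀ {n} {φ : Fm k n} → Bounded φ → IsΣ 0 φ
    σΠ : ∀ {m n} {φ : Fm k (suc n)} → IsΠ m φ → IsΣ (suc m) (`∃ φ)
    σΣ : ∀ {m n} {φ : Fm k (suc n)} → IsΣ (suc m) φ → IsΣ (suc m) (`∃ φ)

  data IsΠ {k : ℕ} : ℕ → {n : ℕ} → Fm k n → Set where
    π₀ : ∀ {n} {φ : Fm k n} → Bounded φ → IsΠ 0 φ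
    πΣ : ∀ {m n} {φ : Fm k (suc n)} → IsΣ m φ → IsΠ (suc m) (`∀ φ)
    πΠ : ∀ {m n} {φ : Fm k (suc n)} → IsΠ (suc m) φ → IsΠ (suc m) (`∀ φ)

-- L₂-structures  𝓜 = (M, 𝓢, 0, 1, +, ·, <, ∈) with 𝓢 given as an index
-- type of sets together with a membership relation; = is interpreted
-- as equality of M.

record Structure : Set₁ where
  field
    M   : Set
    𝓢   : Set
    _∈_ : M → 𝓢 → Set
    O I : M
    _⊕_ _⊗_ : M → M → M
    _≺_ : M → M → Set

module Semantics (𝓜 : Structure) where
  open Structure 𝓜

  ⟦_⟧t : ∀ {n} → Tm n → Vector M n → M
  ⟦ var i ⟧t ρ = ρ i
  ⟦ `0 ⟧t ρ = O
  ⟦ `1 ⟧t ρ = I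
  ⟦ s `+ t ⟧t ρ = ⟦ s ⟧t ρ ⊕ ⟦ t ⟧t ρ
  ⟦ s `* t ⟧t ρ = ⟦ s ⟧t ρ ⊗ ⟦ t ⟧t ρ

  ⟦_⟧ : ∀ {k n} → Fm k n → Vector 𝓢 k → Vector M n → Set
  ⟦ s `= t ⟧ σ ρ = ⟦ s ⟧t ρ ≡ ⟦ t ⟧t ρ
  ⟦ s `< t ⟧ σ ρ = ⟦ s ⟧t ρ ≺ ⟦ t ⟧t ρ
  ⟦ t `∈ X ⟧ σ ρ = ⟦ t ⟧t ρ ∈ σ X
  ⟦ `¬ φ ⟧ σ ρ = ¬ ⟦ φ ⟧ σ ρ
  ⟦ φ `∧ ψ ⟧ σ ρ = ⟦ φ ⟧ σ ρ × ⟦ ψ ⟧ σ ρ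
  ⟦ φ `∨ ψ ⟧ σ ρ = ⟦ φ ⟧ σ ρ ⊎ ⟦ ψ ⟧ σ ρ
  ⟦ φ `⇒ ψ ⟧ σ ρ = ⟦ φ ⟧ σ ρ → ⟦ ψ ⟧ σ ρ
  ⟦ `∀ φ ⟧ σ ρ = ∀ x → ⟦ φ ⟧ σ (x ∷ ρ)
  ⟦ `∃ φ ⟧ σ ρ = Σ M λ x → ⟦ φ ⟧ σ (x ∷ ρ)
  ⟦ `∀< t φ ⟧ σ ρ = ∀ x → x ≺ ⟦ t ⟧t ρ → ⟦ φ ⟧ σ (x ∷ ρ)
  ⟦ `∃< t φ ⟧ σ ρ = Σ M λ x → x ≺ ⟦ t ⟧t ρ × ⟦ φ ⟧ σ (x ∷ ρ)

  IΣ : ℕ → Set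
  IΣ m = ∀ {k n} (φ : Fm k (suc n)) → IsΣ m φ →
         ∀ (σ : Vector 𝓢 k) (ρ : Vector M n) →
         ⟦ φ ⟧ σ (O ∷ ρ) →
         (∀ x → ⟦ φ ⟧ σ (x ∷ ρ) → ⟦ φ ⟧ σ ((x ⊕ I) ∷ ρ)) →
         ∀ x → ⟦ φ ⟧ σ (x ∷ ρ)

  Δ₁-CA : Set
  Δ₁-CA = ∀ {k n} (φ ψ : Fm k (suc n)) → IsΣ 1 φ → IsΠ 1 ψ →
          ∀ (σ : Vector 𝓢 k) (ρ : Vector M n) →
          (∀ x → ⟦ φ ⟧ σ (x ∷ ρ) ⇔ ⟦ ψ ⟧ σ (x ∷ ρ)) →
          Σ 𝓢 λ X → ∀ x → (x ∈ X) ⇔ ⟦ φ ⟧ σ (x ∷ ρ)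

  record IsRCA₀ : Set where
    field
      ax-succ≢0 : ∀ m → ¬ ((m ⊕ I) ≡ O)
      ax-succ-inj : ∀ m n → (m ⊕ I) ≡ (n ⊕ I) → m ≡ n
      ax-+0 : ∀ m → (m ⊕ O) ≡ m
      ax-+S : ∀ m n → (m ⊕ (n ⊕ I)) ≡ ((m ⊕ n) ⊕ I)
      ax-*0 : ∀ m → (m ⊗ O) ≡ O
      ax-*S : ∀ m n → (m ⊗ (n ⊕ I)) ≡ ((m ⊗ n) ⊕ m)
      ax-<0 : ∀ m → ¬ (m ≺ O)
      ax-<S : ∀ m n → (m ≺ (n ⊕ I)) ⇔ ((m ≺ n) ⊎ (m ≡ n))
      ax-IΣ₁ : IΣ 1
      ax-Δ₁-CA : Δ₁-CA

  IΣ⁰₂ : Set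
  IΣ⁰₂ = IΣ 2

  IsΣ⁰ : ∀ (m j : ℕ) → (Vector M j → Set) → Set
  IsΣ⁰ m j P = Σ ℕ λ k → Σ (Fm k j) λ φ → IsΣ m φ × Σ (Vector 𝓢 k) λ σ →
               ∀ ρ → P ρ ⇔ ⟦ φ ⟧ σ ρ

  IsΣ⁰Set : ℕ → (M → Set) → Set
  IsΣ⁰Set m B = IsΣ⁰ m 1 (λ ρ → B (ρ zero))

  -- A partial function Ψ : M² → M given by its graph  Ψ e x y  (Ψ(e,x) = y);
  -- it is a Σ⁰₁ partial function if the graph is functional and Σ⁰₁.
  IsΣ⁰₁PartialFunction : (M → M → M → Set) → Set
  IsΣ⁰₁PartialFunction Ψ =
    (∀ e x y y′ → Ψ e x y → Ψ e x y′ → y ≡ y′) ×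
    IsΣ⁰ 1 3 (λ ρ → Ψ (ρ zero) (ρ (suc zero)) (ρ (suc (suc zero))))

  _IsTotalAndEquals_ : (M → M → Set) → (M → M) → Set
  Ψₑ IsTotalAndEquals f = ∀ x → Ψₑ x (f x)

  Family : Set₁
  Family = (M → M) → Set

  WeaklyRepresented : Family → Set₁
  WeaklyRepresented 𝓕 =
    Σ (M → M → M → Set) λ Θ → IsΣ⁰₁PartialFunction Θ ×
      (∀ f → 𝓕 f ⇔ (Σ M λ e → Θ e IsTotalAndEquals f))

  RestrictedFamily : (M → M → M → Set) → (M → Set) → Family
  RestrictedFamily Ψ B f = Σ M λ e → B e × Ψ e IsTotalAndEquals f

-- Write B = {e : ∃u₁…∃uₘ ∀w₁…∀wⱼ β(e,u,w)} with β bounded.  Let c range over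
-- codes ⟨…⟨e,u₁⟩…,uₘ⟩ of an index together with candidate witnesses, and set
-- Θ_c(x) ≃ Ψ_e(x) provided c is such a code and β(e,u,w) holds for all w < x.
-- This is a Σ⁰₁ condition on (c, x, y); the code c determines e, so Θ is a
-- partial function; and Θ_c is total exactly when Ψ_e is total and the
-- witnesses u coded by c verify e ∈ B, since every w lies below some x.
module Submission where

open import Defs
open import Level using (0ℓ)
open import Axiom.ExcludedMiddle using (ExcludedMiddle)
open import Algebra.Bundles using (CommutativeMonoid)
import Algebra.Solver.CommutativeMonoid as CommutativeMonoidSolver
open import Data.Empty using (⊥-elim)
open import Data.Fin using (Fin; zero; suc; lift; punchIn; inject₁; _↑ˡ_; _↑ʳ_)
open import Data.Nat using (suc; _+_)
open import Data.Product using (Σ; _×_; _,_; proj₁; proj₂; map₂)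
open import Data.Product.Function.NonDependent.Propositional using (_×-⇔_)
open import Data.Sum using (_⊎_; inj₁; inj₂; [_,_]′)
import Data.Sum as Sum
open import Data.Sum.Function.Propositional using (_⊎-⇔_)
open import Data.Vec.Functional using (Vector; _∷_; []; _++_)
open import Data.Vec.Functional.Properties using (lookup-++ˡ; lookup-++ʳ)
open import Function using (id; _∘_)
open import Function.Bundles using (_⇔_; mk⇔; module Equivalence)
open import Function.Construct.Composition using (_⇔-∘_)
open import Function.Construct.Identity using (⇔-id)
open import Function.Construct.Symmetry using (⇔-sym)
open import Function.Related.TypeIsomorphisms using (→-cong-⇔; ¬-cong-⇔)
open import Relation.Binary.PropositionalEquality
  using (_≡_; _≢_; _≗_; refl; sym; trans; cong; cong₂; subst; isEquivalence; module ≡-Reasoning)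

open Equivalence using (to; from)

renameTm : ∀ {n n′} → (Fin n → Fin n′) → Tm n → Tm n′
renameTm r (var i) = var (r i)
renameTm r `0 = `0
renameTm r `1 = `1
renameTm r (s `+ t) = renameTm r s `+ renameTm r t
renameTm r (s `* t) = renameTm r s `* renameTm r t

rename : ∀ {k k′ n n′} → (Fin k → Fin k′) → (Fin n → Fin n′) → Fm k n → Fm k′ n′
rename s r (a `= b) = renameTm r a `= renameTm r b
rename s r (a `< b) = renameTm r a `< renameTm r b
rename s r (a `∈ X) = renameTm r a `∈ s X
rename s r (`¬ φ) = `¬ (rename s r φ)
rename s r (φ `∧ ψ) = rename s r φ `∧ rename s r ψ
rename s r (φ `∨ ψ) = rename s r φ `∨ rename s r ψ
rename s r (φ `⇒ ψ) = rename s r φ `⇒ rename s r ψ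
rename s r (`∀ φ) = `∀ (rename s (lift 1 r) φ)
rename s r (`∃ φ) = `∃ (rename s (lift 1 r) φ)
rename s r (`∀< t φ) = `∀< (renameTm r t) (rename s (lift 1 r) φ)
rename s r (`∃< t φ) = `∃< (renameTm r t) (rename s (lift 1 r) φ)

rename-bounded : ∀ {k k′ n n′} (s : Fin k → Fin k′) (r : Fin n → Fin n′) {φ : Fm k n} →
                 Bounded φ → Bounded (rename s r φ)
rename-bounded s r (b= a b) = b= _ _
rename-bounded s r (b< a b) = b< _ _
rename-bounded s r (b∈ t X) = b∈ _ _
rename-bounded s r (b¬ p) = b¬ (rename-bounded s r p)
rename-bounded s r (b∧ p q) = b∧ (rename-bounded s r p) (rename-bounded s r q)
rename-bounded s r (b∨ p q) = b∨ (rename-bounded s r p) (rename-bounded s r q)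
rename-bounded s r (b⇒ p q) = b⇒ (rename-bounded s r p) (rename-bounded s r q)
rename-bounded s r (b∀< t p) = b∀< _ (rename-bounded s (lift 1 r) p)
rename-bounded s r (b∃< t p) = b∃< _ (rename-bounded s (lift 1 r) p)

mutual
  rename-Σ : ∀ {k k′ n n′ m} (s : Fin k → Fin k′) (r : Fin n → Fin n′) {φ : Fm k n} →
             IsΣ m φ → IsΣ m (rename s r φ)
  rename-Σ s r (σ₀ b) = σ₀ (rename-bounded s r b)
  rename-Σ s r (σΠ p) = σΠ (rename-Π s (lift 1 r) p)
  rename-Σ s r (σΣ p) = σΣ (rename-Σ s (lift 1 r) p)

  rename-Π : ∀ {k k′ n n′ m} (s : Fin k → Fin k′) (r : Fin n → Fin n′) {φ : Fm k n} →
             IsΠ m φ → IsΠ m (rename s r φ)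
  rename-Π s r (π₀ b) = π₀ (rename-bounded s r b)
  rename-Π s r (πΣ p) = πΣ (rename-Σ s (lift 1 r) p)
  rename-Π s r (πΠ p) = πΠ (rename-Π s (lift 1 r) p)

weakenTm : ∀ {n} → Tm n → Tm (suc n)
weakenTm = renameTm suc

weaken : ∀ {k n} → Fm k n → Fm k (suc n)
weaken = rename id suc

v₀ : ∀ {n} → Tm (suc n)
v₀ = var zero

v₁ : ∀ {n} → Tm (suc (suc n))
v₁ = var (suc zero)

v₂ : ∀ {n} → Tm (suc (suc (suc n)))
v₂ = var (suc (suc zero))

pairTm : ∀ {n} → Tm n → Tm n → Tm n
pairTm a b = ((a `+ b) `* (a `+ b)) `+ a

-- belowFm p r X is the truncation ∀w₁<X … ∀wⱼ<X β of the Π₁ formula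
-- ∀w₁…∀wⱼ β, whose free variables are relocated along r.
belowFm : ∀ {k n N} {φ : Fm k n} → IsΠ 1 φ → (Fin n → Fin N) → Fin N → Fm k N
belowFm {φ = `∀ ψ} (πΣ _) r X = `∀< (var X) (rename id (lift 1 r) ψ)
belowFm (πΠ p) r X = `∀< (var X) (belowFm p (lift 1 r) (suc X))

belowFm-bounded : ∀ {k n N} {φ : Fm k n} (p : IsΠ 1 φ) (r : Fin n → Fin N) (X : Fin N) →
                  Bounded (belowFm p r X)
belowFm-bounded (πΣ (σ₀ b)) r X = b∀< _ (rename-bounded id (lift 1 r) b)
belowFm-bounded (πΠ p) r X = b∀< _ (belowFm-bounded p (lift 1 r) (suc X))

-- codedFm q r C c X says: c = ⟨…⟨C,u₁⟩…,uₘ⟩ for witnesses u of the Σ₂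
-- formula ∃u₁…∃uₘ π whose Π₁ matrix π holds truncated at X.
codedFm : ∀ {k n N} {φ : Fm k n} → IsΣ 2 φ → (Fin n → Fin N) → Tm N → (c X : Fin N) → Fm k N
codedFm (σΠ p) r C c X =
  `∃ ((var (suc c) `= pairTm (weakenTm C) v₀) `∧ belowFm p (lift 1 r) (suc X))
codedFm (σΣ q) r C c X = `∃ (codedFm q (lift 1 r) (pairTm (weakenTm C) v₀) (suc c) (suc X))

codedFm-Σ₁ : ∀ {k n N} {φ : Fm k n} (q : IsΣ 2 φ) (r : Fin n → Fin N) (C : Tm N) (c X : Fin N) →
             IsΣ 1 (codedFm q r C c X)
codedFm-Σ₁ (σΠ p) r C c X = σΠ (π₀ (b∧ (b= _ _) (belowFm-bounded p (lift 1 r) (suc X))))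
codedFm-Σ₁ (σΣ q) r C c X = σΣ (codedFm-Σ₁ q (lift 1 r) _ (suc c) (suc X))

module FormulaSemantics (𝓜 : Structure) where
  open Structure 𝓜
  open Semantics 𝓜

  ≡⇒⇔ : ∀ {A B : Set} → A ≡ B → A ⇔ B
  ≡⇒⇔ refl = ⇔-id _

  ∀-cong-⇔ : ∀ {A B : M → Set} → (∀ x → A x ⇔ B x) → (∀ x → A x) ⇔ (∀ x → B x)
  ∀-cong-⇔ A⇔B = mk⇔ (λ f x → to (A⇔B x) (f x)) (λ g x → from (A⇔B x) (g x))

  ∃-cong-⇔ : ∀ {A B : M → Set} → (∀ x → A x ⇔ B x) → Σ M A ⇔ Σ M B
  ∃-cong-⇔ A⇔B = mk⇔ (map₂ λ {x} → to (A⇔B x)) (map₂ λ {x} → from (A⇔B x))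

  lift-≗ : ∀ {n N} {r : Fin n → Fin N} {ρ : Vector M N} {ρ′ : Vector M n} (x : M) →
           ρ ∘ r ≗ ρ′ → (x ∷ ρ) ∘ lift 1 r ≗ (x ∷ ρ′)
  lift-≗ x hr zero = refl
  lift-≗ x hr (suc i) = hr i

  ⟦renameTm⟧ : ∀ {n N} (r : Fin n → Fin N) (t : Tm n) {ρ : Vector M N} {ρ′ : Vector M n} →
               ρ ∘ r ≗ ρ′ → ⟦ renameTm r t ⟧t ρ ≡ ⟦ t ⟧t ρ′
  ⟦renameTm⟧ r (var i) hr = hr i
  ⟦renameTm⟧ r `0 hr = refl
  ⟦renameTm⟧ r `1 hr = refl
  ⟦renameTm⟧ r (a `+ b) hr = cong₂ _⊕_ (⟦renameTm⟧ r a hr) (⟦renameTm⟧ r b hr)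
  ⟦renameTm⟧ r (a `* b) hr = cong₂ _⊗_ (⟦renameTm⟧ r a hr) (⟦renameTm⟧ r b hr)

  ⟦rename⟧ : ∀ {k K n N} (s : Fin k → Fin K) (r : Fin n → Fin N) (φ : Fm k n)
             {σ : Vector 𝓢 K} {σ′ : Vector 𝓢 k} {ρ : Vector M N} {ρ′ : Vector M n} →
             σ ∘ s ≗ σ′ → ρ ∘ r ≗ ρ′ → ⟦ rename s r φ ⟧ σ ρ ⇔ ⟦ φ ⟧ σ′ ρ′
  ⟦rename⟧ s r (a `= b) hs hr = ≡⇒⇔ (cong₂ _≡_ (⟦renameTm⟧ r a hr) (⟦renameTm⟧ r b hr))
  ⟦rename⟧ s r (a `< b) hs hr = ≡⇒⇔ (cong₂ _≺_ (⟦renameTm⟧ r a hr) (⟦renameTm⟧ r b hr))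
  ⟦rename⟧ s r (a `∈ X) hs hr = ≡⇒⇔ (cong₂ _∈_ (⟦renameTm⟧ r a hr) (hs X))
  ⟦rename⟧ s r (`¬ φ) hs hr = ¬-cong-⇔ (⟦rename⟧ s r φ hs hr)
  ⟦rename⟧ s r (φ `∧ ψ) hs hr = ⟦rename⟧ s r φ hs hr ×-⇔ ⟦rename⟧ s r ψ hs hr
  ⟦rename⟧ s r (φ `∨ ψ) hs hr = ⟦rename⟧ s r φ hs hr ⊎-⇔ ⟦rename⟧ s r ψ hs hr
  ⟦rename⟧ s r (φ `⇒ ψ) hs hr = →-cong-⇔ (⟦rename⟧ s r φ hs hr) (⟦rename⟧ s r ψ hs hr)
  ⟦rename⟧ s r (`∀ φ) hs hr = ∀-cong-⇔ λ x → ⟦rename⟧ s (lift 1 r) φ hs (lift-≗ x hr)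
  ⟦rename⟧ s r (`∃ φ) hs hr = ∃-cong-⇔ λ x → ⟦rename⟧ s (lift 1 r) φ hs (lift-≗ x hr)
  ⟦rename⟧ s r (`∀< t φ) hs hr = ∀-cong-⇔ λ x →
    →-cong-⇔ (≡⇒⇔ (cong (x ≺_) (⟦renameTm⟧ r t hr))) (⟦rename⟧ s (lift 1 r) φ hs (lift-≗ x hr))
  ⟦rename⟧ s r (`∃< t φ) hs hr = ∃-cong-⇔ λ x →
    ≡⇒⇔ (cong (x ≺_) (⟦renameTm⟧ r t hr)) ×-⇔ ⟦rename⟧ s (lift 1 r) φ hs (lift-≗ x hr)

  ⟦weakenTm⟧ : ∀ {n} (t : Tm n) {ρ : Vector M n} {x : M} → ⟦ weakenTm t ⟧t (x ∷ ρ) ≡ ⟦ t ⟧t ρ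
  ⟦weakenTm⟧ t = ⟦renameTm⟧ suc t λ _ → refl

  ⟦weaken⟧ : ∀ {k n} (φ : Fm k n) {σ : Vector 𝓢 k} {ρ : Vector M n} {x : M} →
             ⟦ weaken φ ⟧ σ (x ∷ ρ) ⇔ ⟦ φ ⟧ σ ρ
  ⟦weaken⟧ φ = ⟦rename⟧ id suc φ (λ _ → refl) (λ _ → refl)

  infix 4 _≋_
  _≋_ : ∀ {k n} → Fm k n → Fm k n → Set
  φ ≋ ψ = ∀ σ ρ → ⟦ φ ⟧ σ ρ ⇔ ⟦ ψ ⟧ σ ρ

  ∃-∧ˡ : ∀ {k n} (φ : Fm k (suc n)) (ψ : Fm k n) → `∃ (φ `∧ weaken ψ) ≋ `∃ φ `∧ ψ
  ∃-∧ˡ φ ψ σ ρ = mk⇔ (λ (x , a , b) → (x , a) , to (⟦weaken⟧ ψ) b)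
                     (λ ((x , a) , b) → x , a , from (⟦weaken⟧ ψ) b)

  ∃-∧ʳ : ∀ {k n} (φ : Fm k n) (ψ : Fm k (suc n)) → `∃ (weaken φ `∧ ψ) ≋ φ `∧ `∃ ψ
  ∃-∧ʳ φ ψ σ ρ = mk⇔ (λ (x , a , b) → to (⟦weaken⟧ φ) a , x , b)
                     (λ (a , x , b) → x , from (⟦weaken⟧ φ) a , b)

  record Σ₁Equivalent {k n} (φ : Fm k n) : Set where
    constructor mkΣ₁Equivalent
    field
      formula : Fm k n
      formula-Σ₁ : IsΣ 1 formula
      formula≋ : formula ≋ φ

  Σ₁Equivalent-≋ : ∀ {k n} {φ ψ : Fm k n} → Σ₁Equivalent φ → φ ≋ ψ → Σ₁Equivalent ψ
  Σ₁Equivalent-≋ (mkΣ₁Equivalent χ χ-Σ₁ χ≋φ) φ≋ψ = mkΣ₁Equivalent χ χ-Σ₁ λ σ ρ → φ≋ψ σ ρ ⇔-∘ χ≋φ σ ρ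

  ∃-Σ₁Equivalent : ∀ {k n} {φ : Fm k (suc n)} → Σ₁Equivalent φ → Σ₁Equivalent (`∃ φ)
  ∃-Σ₁Equivalent (mkΣ₁Equivalent χ χ-Σ₁ χ≋φ) =
    mkΣ₁Equivalent (`∃ χ) (σΣ χ-Σ₁) λ σ ρ → ∃-cong-⇔ λ x → χ≋φ σ (x ∷ ρ)

  bounded-∧-Σ₁ : ∀ {k n} {φ ψ : Fm k n} → Bounded φ → IsΣ 1 ψ → Σ₁Equivalent (φ `∧ ψ)
  bounded-∧-Σ₁ {φ = φ} {`∃ ψ} φ-bd (σΠ (π₀ ψ-bd)) =
    mkΣ₁Equivalent (`∃ (weaken φ `∧ ψ)) (σΠ (π₀ (b∧ (rename-bounded id suc φ-bd) ψ-bd))) (∃-∧ʳ φ ψ)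
  bounded-∧-Σ₁ {φ = φ} {`∃ ψ} φ-bd (σΣ ψ-Σ₁) =
    Σ₁Equivalent-≋ (∃-Σ₁Equivalent (bounded-∧-Σ₁ (rename-bounded id suc φ-bd) ψ-Σ₁)) (∃-∧ʳ φ ψ)

  ∧-Σ₁ : ∀ {k n} {φ ψ : Fm k n} → IsΣ 1 φ → IsΣ 1 ψ → Σ₁Equivalent (φ `∧ ψ)
  ∧-Σ₁ {φ = `∃ φ} {ψ} (σΠ (π₀ φ-bd)) ψ-Σ₁ =
    Σ₁Equivalent-≋ (∃-Σ₁Equivalent (bounded-∧-Σ₁ φ-bd (rename-Σ id suc ψ-Σ₁))) (∃-∧ˡ φ ψ)
  ∧-Σ₁ {φ = `∃ φ} {ψ} (σΣ φ-Σ₁) ψ-Σ₁ =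
    Σ₁Equivalent-≋ (∃-Σ₁Equivalent (∧-Σ₁ φ-Σ₁ (rename-Σ id suc ψ-Σ₁))) (∃-∧ˡ φ ψ)

  Σ⁰-rename : ∀ {m j j′} {P : Vector M j → Set} (r : Fin j → Fin j′) →
              IsΣ⁰ m j P → IsΣ⁰ m j′ (λ ρ → P (ρ ∘ r))
  Σ⁰-rename r (k , φ , φ-Σ , σ , P⇔φ) =
    k , rename id r φ , rename-Σ id r φ-Σ , σ ,
    λ ρ → ⇔-sym (⟦rename⟧ id r φ (λ _ → refl) (λ _ → refl)) ⇔-∘ P⇔φ (ρ ∘ r)

  Σ⁰₁-∃ : ∀ {j} {P : Vector M (suc j) → Set} →
          IsΣ⁰ 1 (suc j) P → IsΣ⁰ 1 j (λ ρ → Σ M λ x → P (x ∷ ρ))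
  Σ⁰₁-∃ (k , φ , φ-Σ₁ , σ , P⇔φ) = k , `∃ φ , σΣ φ-Σ₁ , σ , λ ρ → ∃-cong-⇔ λ x → P⇔φ (x ∷ ρ)

  Σ⁰₁-× : ∀ {j} {P Q : Vector M j → Set} →
          IsΣ⁰ 1 j P → IsΣ⁰ 1 j Q → IsΣ⁰ 1 j (λ ρ → P ρ × Q ρ)
  Σ⁰₁-× (kP , φ , φ-Σ₁ , σP , P⇔φ) (kQ , ψ , ψ-Σ₁ , σQ , Q⇔ψ)
    with ∧-Σ₁ (rename-Σ (_↑ˡ kQ) id φ-Σ₁) (rename-Σ (kP ↑ʳ_) id ψ-Σ₁)
  ... | mkΣ₁Equivalent χ χ-Σ₁ χ≋ = kP + kQ , χ , χ-Σ₁ , σP ++ σQ , λ ρ →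
    ⇔-sym (χ≋ (σP ++ σQ) ρ) ⇔-∘
    ((⇔-sym (⟦rename⟧ (_↑ˡ kQ) id φ (lookup-++ˡ σP σQ) (λ _ → refl)) ⇔-∘ P⇔φ ρ) ×-⇔
     (⇔-sym (⟦rename⟧ (kP ↑ʳ_) id ψ (lookup-++ʳ σP σQ) (λ _ → refl)) ⇔-∘ Q⇔ψ ρ))

uniform-witness : ∀ {A : Set} {P : A → A → Set} (a : A) → (∀ x → Σ A (P x)) →
                  (∀ {x y u v} → P x u → P y v → u ≡ v) → Σ A λ u → ∀ x → P x u
uniform-witness {P = P} a H unique =
  proj₁ (H a) , λ x → subst (P x) (unique (proj₂ (H x)) (proj₂ (H a))) (proj₂ (H x))

module _ (𝓜 : Structure) where
  open Structure 𝓜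

  record Σ⁰₂Witnessing (B : M → Set) : Set₁ where
    field
      Witness : M → M → M → Set
      Witness-Σ⁰₁ : Semantics.IsΣ⁰ 𝓜 1 3 (λ ρ → Witness (ρ zero) (ρ (suc zero)) (ρ (suc (suc zero))))
      witness-exists : ∀ {e} → B e → Σ M λ c → ∀ X → Witness e c X
      witness-determines : ∀ {e e′ c X X′} → Witness e c X → Witness e′ c X′ → e ≡ e′
      witness-sound : ∀ {e c} → (∀ X → Witness e c X) → B e

module Representation (𝓜 : Structure) where
  open Structure 𝓜
  open Semantics 𝓜
  open FormulaSemantics 𝓜

  restrictedFamily-weaklyRepresented :
    ∀ {Ψ B} → IsΣ⁰₁PartialFunction Ψ → Σ⁰₂Witnessing 𝓜 B → WeaklyRepresented (RestrictedFamily Ψ B)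
  restrictedFamily-weaklyRepresented {Ψ} {B} (Ψ-functional , Ψ-Σ⁰₁) W =
    Θ , (Θ-functional , Θ-Σ⁰₁) , λ f → mk⇔ (represent f) (unrepresent f)
    where
    open Σ⁰₂Witnessing W

    Θ : M → M → M → Set
    Θ c x y = Σ M λ e → Ψ e x y × Witness e c x

    Θ-functional : ∀ c x y y′ → Θ c x y → Θ c x y′ → y ≡ y′
    Θ-functional c x y y′ (e , Ψexy , w) (e′ , Ψe′xy′ , w′) =
      Ψ-functional e x y y′ Ψexy (subst (λ e → Ψ e x y′) (witness-determines w′ w) Ψe′xy′)

    Θ-Σ⁰₁ : IsΣ⁰ 1 3 (λ ρ → Θ (ρ zero) (ρ (suc zero)) (ρ (suc (suc zero))))
    Θ-Σ⁰₁ = Σ⁰₁-∃ (Σ⁰₁-× (Σ⁰-rename (punchIn (suc zero)) Ψ-Σ⁰₁) (Σ⁰-rename inject₁ Witness-Σ⁰₁))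

    represent : ∀ f → RestrictedFamily Ψ B f → Σ M λ c → Θ c IsTotalAndEquals f
    represent f (e , Be , Ψe≡f) = let c , w = witness-exists Be in c , λ x → e , Ψe≡f x , w x

    unrepresent : ∀ f → (Σ M λ c → Θ c IsTotalAndEquals f) → RestrictedFamily Ψ B f
    unrepresent f (c , Θc≡f) =
      let e , H = uniform-witness O Θc≡f λ (_ , w) (_ , w′) → witness-determines w w′
      in e , witness-sound (λ x → proj₂ (H x)) , λ x → proj₁ (H x)

module Arithmetic (𝓜 : Structure) (rca : Semantics.IsRCA₀ 𝓜) where
  open Structure 𝓜
  open Semantics 𝓜
  open IsRCA₀ rca
  open FormulaSemantics 𝓜
  open ≡-Reasoning

  Δ₀-induction : ∀ {k n} (φ : Fm k (suc n)) → Bounded φ → ∀ σ ρ →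
                 ⟦ φ ⟧ σ (O ∷ ρ) → (∀ x → ⟦ φ ⟧ σ (x ∷ ρ) → ⟦ φ ⟧ σ ((x ⊕ I) ∷ ρ)) →
                 ∀ x → ⟦ φ ⟧ σ (x ∷ ρ)
  Δ₀-induction φ φ-bd σ ρ base step x =
    to (⟦weaken⟧ φ) (proj₂ (ax-IΣ₁ (`∃ (weaken φ)) (σΠ (π₀ (rename-bounded id suc φ-bd))) σ ρ
      (O , from (⟦weaken⟧ φ) base)
      (λ x (z , h) → z , from (⟦weaken⟧ φ) (step x (to (⟦weaken⟧ φ) h))) x))

  infix 4 _≼_
  _≼_ : M → M → Set
  a ≼ b = a ≺ b ⊎ a ≡ b

  ≼⇒<suc : ∀ {a b} → a ≼ b → a ≺ (b ⊕ I)
  ≼⇒<suc = from (ax-<S _ _)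

  <suc⇒≼ : ∀ {a b} → a ≺ (b ⊕ I) → a ≼ b
  <suc⇒≼ = to (ax-<S _ _)

  0≼ : ∀ b → O ≼ b
  0≼ = Δ₀-induction ((`0 `< v₀) `∨ (`0 `= v₀)) (b∨ (b< _ _) (b= _ _)) [] []
         (inj₂ refl) (λ x h → inj₁ (≼⇒<suc h))

  <⇒suc≼ : ∀ {a b} → a ≺ b → (a ⊕ I) ≼ b
  <⇒suc≼ {a} {b} = Δ₀-induction ((v₁ `< v₀) `⇒ (((v₁ `+ `1) `< v₀) `∨ ((v₁ `+ `1) `= v₀)))
                     (b⇒ (b< _ _) (b∨ (b< _ _) (b= _ _))) [] (a ∷ [])
                     (⊥-elim ∘ ax-<0 a) step b
    where
    step : ∀ x → (a ≺ x → (a ⊕ I) ≼ x) → a ≺ (x ⊕ I) → (a ⊕ I) ≼ (x ⊕ I)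
    step x IH a<x+1 with <suc⇒≼ a<x+1
    ... | inj₁ a<x = inj₁ (≼⇒<suc (IH a<x))
    ... | inj₂ a≡x = inj₂ (cong (_⊕ I) a≡x)

  <-trichotomy : ∀ a b → a ≺ b ⊎ a ≡ b ⊎ b ≺ a
  <-trichotomy a b = Δ₀-induction ((v₀ `< v₁) `∨ ((v₀ `= v₁) `∨ (v₁ `< v₀)))
                       (b∨ (b< _ _) (b∨ (b= _ _) (b< _ _))) [] (b ∷ [])
                       (Sum.map₂ inj₁ (0≼ b)) step a
    where
    step : ∀ x → x ≺ b ⊎ x ≡ b ⊎ b ≺ x → (x ⊕ I) ≺ b ⊎ (x ⊕ I) ≡ b ⊎ b ≺ (x ⊕ I)
    step x (inj₁ x<b) = Sum.map₂ inj₁ (<⇒suc≼ x<b)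
    step x (inj₂ (inj₁ x≡b)) = inj₂ (inj₂ (≼⇒<suc (inj₂ (sym x≡b))))
    step x (inj₂ (inj₂ b<x)) = inj₂ (inj₂ (≼⇒<suc (inj₁ b<x)))

  <-trans : ∀ {a b c} → a ≺ b → b ≺ c → a ≺ c
  <-trans {a} {b} {c} a<b = Δ₀-induction ((v₁ `< v₀) `⇒ (v₂ `< v₀)) (b⇒ (b< _ _) (b< _ _))
                              [] (b ∷ a ∷ []) (⊥-elim ∘ ax-<0 b) step c
    where
    step : ∀ x → (b ≺ x → a ≺ x) → b ≺ (x ⊕ I) → a ≺ (x ⊕ I)
    step x IH b<x+1 = ≼⇒<suc (inj₁ ([ IH , (λ b≡x → subst (a ≺_) b≡x a<b) ]′ (<suc⇒≼ b<x+1)))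

  upper-bound : ∀ a b → Σ M λ c → a ≺ c × b ≺ c
  upper-bound a b with <-trichotomy a b
  ... | inj₁ a<b = b ⊕ I , ≼⇒<suc (inj₁ a<b) , ≼⇒<suc (inj₂ refl)
  ... | inj₂ (inj₁ a≡b) = b ⊕ I , ≼⇒<suc (inj₂ a≡b) , ≼⇒<suc (inj₂ refl)
  ... | inj₂ (inj₂ b<a) = a ⊕ I , ≼⇒<suc (inj₂ refl) , ≼⇒<suc (inj₁ b<a)

  <⇒≡+suc : ∀ {a b} → a ≺ b → Σ M λ d → b ≡ a ⊕ (d ⊕ I)
  <⇒≡+suc {a} {b} a<b =
    map₂ proj₂ (Δ₀-induction ((v₁ `< v₀) `⇒ `∃< v₀ (v₁ `= (v₂ `+ (v₀ `+ `1))))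
                  (b⇒ (b< _ _) (b∃< _ (b= _ _))) [] (a ∷ []) (⊥-elim ∘ ax-<0 a) step b a<b)
    where
    step : ∀ x → (a ≺ x → Σ M λ d → d ≺ x × x ≡ a ⊕ (d ⊕ I)) →
           a ≺ (x ⊕ I) → Σ M λ d → d ≺ (x ⊕ I) × (x ⊕ I) ≡ a ⊕ (d ⊕ I)
    step x IH a<x+1 with <suc⇒≼ a<x+1
    ... | inj₁ a<x = let d , d<x , x≡ = IH a<x in
      d ⊕ I , ≼⇒<suc (<⇒suc≼ d<x) , trans (cong (_⊕ I) x≡) (sym (ax-+S a (d ⊕ I)))
    ... | inj₂ a≡x =
      O , ≼⇒<suc (0≼ x) , sym (trans (ax-+S a O) (cong (_⊕ I) (trans (ax-+0 a) a≡x)))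

  +-identityˡ : ∀ a → O ⊕ a ≡ a
  +-identityˡ = Δ₀-induction ((`0 `+ v₀) `= v₀) (b= _ _) [] []
                  (ax-+0 O) (λ x h → trans (ax-+S O x) (cong (_⊕ I) h))

  +-sucˡ : ∀ a b → (a ⊕ I) ⊕ b ≡ (a ⊕ b) ⊕ I
  +-sucˡ a = Δ₀-induction (((v₁ `+ `1) `+ v₀) `= ((v₁ `+ v₀) `+ `1)) (b= _ _) [] (a ∷ [])
               (trans (ax-+0 _) (cong (_⊕ I) (sym (ax-+0 a))))
               (λ x h → trans (ax-+S _ x) (trans (cong (_⊕ I) h) (cong (_⊕ I) (sym (ax-+S a x)))))

  +-comm : ∀ a b → a ⊕ b ≡ b ⊕ a
  +-comm a = Δ₀-induction ((v₁ `+ v₀) `= (v₀ `+ v₁)) (b= _ _) [] (a ∷ [])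
               (trans (ax-+0 a) (sym (+-identityˡ a)))
               (λ x h → trans (ax-+S a x) (trans (cong (_⊕ I) h) (sym (+-sucˡ x a))))

  +-assoc : ∀ a b c → (a ⊕ b) ⊕ c ≡ a ⊕ (b ⊕ c)
  +-assoc a b = Δ₀-induction (((v₂ `+ v₁) `+ v₀) `= (v₂ `+ (v₁ `+ v₀))) (b= _ _) [] (b ∷ a ∷ [])
                  (trans (ax-+0 _) (cong (a ⊕_) (sym (ax-+0 b))))
                  (λ x h → begin
                    (a ⊕ b) ⊕ (x ⊕ I) ≡⟨ ax-+S _ x ⟩
                    ((a ⊕ b) ⊕ x) ⊕ I ≡⟨ cong (_⊕ I) h ⟩
                    (a ⊕ (b ⊕ x)) ⊕ I ≡⟨ ax-+S a _ ⟨
                    a ⊕ ((b ⊕ x) ⊕ I) ≡⟨ cong (a ⊕_) (ax-+S b x) ⟨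
                    a ⊕ (b ⊕ (x ⊕ I)) ∎)

  +-cancelˡ : ∀ a {b c} → a ⊕ b ≡ a ⊕ c → b ≡ c
  +-cancelˡ a {b} {c} = Δ₀-induction (((v₀ `+ v₁) `= (v₀ `+ v₂)) `⇒ (v₁ `= v₂)) (b⇒ (b= _ _) (b= _ _))
                          [] (b ∷ c ∷ [])
                          (λ e → trans (sym (+-identityˡ b)) (trans e (+-identityˡ c)))
                          (λ x h e → h (ax-succ-inj _ _ (trans (sym (+-sucˡ x b)) (trans e (+-sucˡ x c)))))
                          a

  m≢m+[n+1] : ∀ m n → m ≢ m ⊕ (n ⊕ I)
  m≢m+[n+1] m n m≡ = ax-succ≢0 n (sym (+-cancelˡ m (trans (ax-+0 m) m≡)))

  +-commutativeMonoid : CommutativeMonoid 0ℓ 0ℓ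
  +-commutativeMonoid = record
    { Carrier = M
    ; _≈_ = _≡_
    ; _∙_ = _⊕_
    ; ε = O
    ; isCommutativeMonoid = record
      { isMonoid = record
        { isSemigroup = record
          { isMagma = record { isEquivalence = isEquivalence ; ∙-cong = cong₂ _⊕_ }
          ; assoc = +-assoc
          }
        ; identity = +-identityˡ , ax-+0
        }
      ; comm = +-comm
      }
    }

  open CommutativeMonoidSolver +-commutativeMonoid using (solve; _⊜_) renaming (_⊕_ to _⊞_)

  *-distribˡ-+ : ∀ a b c → a ⊗ (b ⊕ c) ≡ (a ⊗ b) ⊕ (a ⊗ c)
  *-distribˡ-+ a b = Δ₀-induction ((v₂ `* (v₁ `+ v₀)) `= ((v₂ `* v₁) `+ (v₂ `* v₀))) (b= _ _)
                       [] (b ∷ a ∷ [])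
                       (begin
                         a ⊗ (b ⊕ O)       ≡⟨ cong (a ⊗_) (ax-+0 b) ⟩
                         a ⊗ b             ≡⟨ ax-+0 _ ⟨
                         (a ⊗ b) ⊕ O       ≡⟨ cong ((a ⊗ b) ⊕_) (ax-*0 a) ⟨
                         (a ⊗ b) ⊕ (a ⊗ O) ∎)
                       (λ x h → begin
                         a ⊗ (b ⊕ (x ⊕ I))       ≡⟨ cong (a ⊗_) (ax-+S b x) ⟩
                         a ⊗ ((b ⊕ x) ⊕ I)       ≡⟨ ax-*S a _ ⟩
                         (a ⊗ (b ⊕ x)) ⊕ a       ≡⟨ cong (_⊕ a) h ⟩
                         ((a ⊗ b) ⊕ (a ⊗ x)) ⊕ a ≡⟨ +-assoc _ _ _ ⟩
                         (a ⊗ b) ⊕ ((a ⊗ x) ⊕ a) ≡⟨ cong ((a ⊗ b) ⊕_) (ax-*S a x) ⟨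
                         (a ⊗ b) ⊕ (a ⊗ (x ⊕ I)) ∎)

  *-distribʳ-+ : ∀ a b c → (a ⊕ b) ⊗ c ≡ (a ⊗ c) ⊕ (b ⊗ c)
  *-distribʳ-+ a b = Δ₀-induction (((v₂ `+ v₁) `* v₀) `= ((v₂ `* v₀) `+ (v₁ `* v₀))) (b= _ _)
                       [] (b ∷ a ∷ [])
                       (begin
                         (a ⊕ b) ⊗ O       ≡⟨ ax-*0 _ ⟩
                         O                 ≡⟨ ax-+0 O ⟨
                         O ⊕ O             ≡⟨ cong₂ _⊕_ (ax-*0 a) (ax-*0 b) ⟨
                         (a ⊗ O) ⊕ (b ⊗ O) ∎)
                       (λ x h → begin
                         (a ⊕ b) ⊗ (x ⊕ I)             ≡⟨ ax-*S _ x ⟩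
                         ((a ⊕ b) ⊗ x) ⊕ (a ⊕ b)       ≡⟨ cong (_⊕ (a ⊕ b)) h ⟩
                         ((a ⊗ x) ⊕ (b ⊗ x)) ⊕ (a ⊕ b) ≡⟨ solve 4 (λ p q r s → (p ⊞ q) ⊞ (r ⊞ s) ⊜ (p ⊞ r) ⊞ (q ⊞ s))
                                                           refl (a ⊗ x) (b ⊗ x) a b ⟩
                         ((a ⊗ x) ⊕ a) ⊕ ((b ⊗ x) ⊕ b) ≡⟨ cong₂ _⊕_ (ax-*S a x) (ax-*S b x) ⟨
                         (a ⊗ (x ⊕ I)) ⊕ (b ⊗ (x ⊕ I)) ∎)

  pair : M → M → M
  pair a b = ((a ⊕ b) ⊗ (a ⊕ b)) ⊕ a

  -- Writing s = a + b and s′ = s + t with t ≥ 1, the square s′² already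
  -- exceeds s² + s ≥ s² + a, so pair a b cannot catch up with pair a′ b′.
  pair-≢-of-sum-< : ∀ a b a′ b′ d → a′ ⊕ b′ ≡ (a ⊕ b) ⊕ (d ⊕ I) → pair a b ≢ pair a′ b′
  pair-≢-of-sum-< a b a′ b′ d s′≡s+t eq = m≢m+[n+1] s ((R ⊕ a′) ⊕ b) s≡
    where
    s = a ⊕ b
    t = d ⊕ I
    s′ = a′ ⊕ b′
    R = ((t ⊗ s) ⊕ (s′ ⊗ d)) ⊕ d
    square : s′ ⊗ s′ ≡ (s ⊗ s) ⊕ (s ⊕ (R ⊕ I))
    square = begin
      s′ ⊗ s′                                     ≡⟨ cong (s′ ⊗_) s′≡s+t ⟩
      s′ ⊗ (s ⊕ t)                                ≡⟨ *-distribˡ-+ s′ s t ⟩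
      (s′ ⊗ s) ⊕ (s′ ⊗ t)                         ≡⟨ cong₂ _⊕_ (cong (_⊗ s) s′≡s+t) (ax-*S s′ d) ⟩
      ((s ⊕ t) ⊗ s) ⊕ ((s′ ⊗ d) ⊕ s′)             ≡⟨ cong₂ _⊕_ (*-distribʳ-+ s t s) (cong ((s′ ⊗ d) ⊕_) s′≡s+t) ⟩
      ((s ⊗ s) ⊕ (t ⊗ s)) ⊕ ((s′ ⊗ d) ⊕ (s ⊕ t))  ≡⟨ solve 6 (λ x₁ x₂ x₃ x₄ x₅ x₆ →
                                                         (x₁ ⊞ x₂) ⊞ (x₃ ⊞ (x₄ ⊞ (x₅ ⊞ x₆))) ⊜
                                                         x₁ ⊞ (x₄ ⊞ (((x₂ ⊞ x₃) ⊞ x₅) ⊞ x₆)))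
                                                       refl (s ⊗ s) (t ⊗ s) (s′ ⊗ d) s d I ⟩
      (s ⊗ s) ⊕ (s ⊕ (R ⊕ I))                     ∎
    a≡ : a ≡ (s ⊕ (R ⊕ I)) ⊕ a′
    a≡ = +-cancelˡ (s ⊗ s) (trans eq (trans (cong (_⊕ a′) square) (+-assoc _ _ _)))
    s≡ : s ≡ s ⊕ (((R ⊕ a′) ⊕ b) ⊕ I)
    s≡ = begin
      a ⊕ b                        ≡⟨ cong (_⊕ b) a≡ ⟩
      ((s ⊕ (R ⊕ I)) ⊕ a′) ⊕ b     ≡⟨ solve 5 (λ x₁ x₂ x₃ x₄ x₅ →
                                        ((x₁ ⊞ (x₂ ⊞ x₃)) ⊞ x₄) ⊞ x₅ ⊜ x₁ ⊞ (((x₂ ⊞ x₄) ⊞ x₅) ⊞ x₃))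
                                      refl s R I a′ b ⟩
      s ⊕ (((R ⊕ a′) ⊕ b) ⊕ I)     ∎

  pair-injective : ∀ {a b a′ b′} → pair a b ≡ pair a′ b′ → a ≡ a′ × b ≡ b′
  pair-injective {a} {b} {a′} {b′} eq with <-trichotomy (a ⊕ b) (a′ ⊕ b′)
  ... | inj₁ s<s′ = let d , s′≡ = <⇒≡+suc s<s′ in ⊥-elim (pair-≢-of-sum-< a b a′ b′ d s′≡ eq)
  ... | inj₂ (inj₂ s′<s) = let d , s≡ = <⇒≡+suc s′<s in ⊥-elim (pair-≢-of-sum-< a′ b′ a b d s≡ (sym eq))
  ... | inj₂ (inj₁ s≡s′) = a≡a′ , +-cancelˡ a′ (trans (cong (_⊕ b) (sym a≡a′)) s≡s′)
    where
    a≡a′ : a ≡ a′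
    a≡a′ = +-cancelˡ _ (trans eq (cong (λ s → (s ⊗ s) ⊕ a′) (sym s≡s′)))

module Truncation (𝓜 : Structure) (rca : Semantics.IsRCA₀ 𝓜) where
  open Structure 𝓜
  open Semantics 𝓜
  open FormulaSemantics 𝓜
  open Arithmetic 𝓜 rca

  Below : ∀ {k n} {φ : Fm k n} → IsΠ 1 φ → M → Vector 𝓢 k → Vector M n → Set
  Below {φ = `∀ ψ} (πΣ _) X σ ρ = ∀ w → w ≺ X → ⟦ ψ ⟧ σ (w ∷ ρ)
  Below (πΠ p) X σ ρ = ∀ w → w ≺ X → Below p X σ (w ∷ ρ)

  Below-mono : ∀ {k n} {φ : Fm k n} (p : IsΠ 1 φ) {σ ρ X Y} → Y ≺ X → Below p X σ ρ → Below p Y σ ρ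
  Below-mono (πΣ _) Y<X h w w<Y = h w (<-trans w<Y Y<X)
  Below-mono (πΠ p) Y<X h w w<Y = Below-mono p Y<X (h w (<-trans w<Y Y<X))

  ⟦⟧⇔Below : ∀ {k n} {φ : Fm k n} (p : IsΠ 1 φ) {σ ρ} → ⟦ φ ⟧ σ ρ ⇔ (∀ X → Below p X σ ρ)
  ⟦⟧⇔Below p = mk⇔ (truncate p) (untruncate p)
    where
    truncate : ∀ {k n} {φ : Fm k n} (p : IsΠ 1 φ) {σ ρ} → ⟦ φ ⟧ σ ρ → ∀ X → Below p X σ ρ
    truncate (πΣ _) h X w _ = h w
    truncate (πΠ p) h X w _ = truncate p (h w) X
    -- a common bound X of Y and w turns truncations at X into the truncation at Y above w
    untruncate : ∀ {k n} {φ : Fm k n} (p : IsΠ 1 φ) {σ ρ} → (∀ X → Below p X σ ρ) → ⟦ φ ⟧ σ ρ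
    untruncate (πΣ _) H w = H (w ⊕ I) w (≼⇒<suc (inj₂ refl))
    untruncate (πΠ p) H w = untruncate p λ Y →
      let X , Y<X , w<X = upper-bound Y w in Below-mono p Y<X (H X w w<X)

  Coded : ∀ {k n} {φ : Fm k n} → IsΣ 2 φ → (C c X : M) → Vector 𝓢 k → Vector M n → Set
  Coded (σΠ p) C c X σ ρ = Σ M λ u → c ≡ pair C u × Below p X σ (u ∷ ρ)
  Coded (σΣ q) C c X σ ρ = Σ M λ u → Coded q (pair C u) c X σ (u ∷ ρ)

  ⟦⟧⇒Coded : ∀ {k n} {φ : Fm k n} (q : IsΣ 2 φ) {σ ρ} → ⟦ φ ⟧ σ ρ →
             ∀ C → Σ M λ c → ∀ X → Coded q C c X σ ρ
  ⟦⟧⇒Coded (σΠ p) (u , h) C = pair C u , λ X → u , refl , to (⟦⟧⇔Below p) h X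
  ⟦⟧⇒Coded (σΣ q) (u , h) C = let c , H = ⟦⟧⇒Coded q h (pair C u) in c , λ X → u , H X

  Coded-injective : ∀ {k n} {φ : Fm k n} (q : IsΣ 2 φ) {σ ρ₁ ρ₂ C₁ C₂ c X₁ X₂} →
                    Coded q C₁ c X₁ σ ρ₁ → Coded q C₂ c X₂ σ ρ₂ → C₁ ≡ C₂
  Coded-injective (σΠ p) (_ , c≡₁ , _) (_ , c≡₂ , _) = proj₁ (pair-injective (trans (sym c≡₁) c≡₂))
  Coded-injective (σΣ q) (_ , h₁) (_ , h₂) = proj₁ (pair-injective (Coded-injective q h₁ h₂))

  Coded⇒⟦⟧ : ∀ {k n} {φ : Fm k n} (q : IsΣ 2 φ) {σ ρ C c} → (∀ X → Coded q C c X σ ρ) → ⟦ φ ⟧ σ ρ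
  Coded⇒⟦⟧ (σΠ p) H =
    let u , Hu = uniform-witness O H λ (c≡₁ , _) (c≡₂ , _) →
                   proj₂ (pair-injective (trans (sym c≡₁) c≡₂))
    in u , from (⟦⟧⇔Below p) (λ X → proj₂ (Hu X))
  Coded⇒⟦⟧ (σΣ q) H =
    let u , Hu = uniform-witness O H λ h₁ h₂ → proj₂ (pair-injective (Coded-injective q h₁ h₂))
    in u , Coded⇒⟦⟧ q Hu

  ⟦belowFm⟧ : ∀ {k n N} {φ : Fm k n} (p : IsΠ 1 φ) (r : Fin n → Fin N) (X : Fin N)
              {σ : Vector 𝓢 k} {ρ : Vector M N} {ρ′ : Vector M n} →
              ρ ∘ r ≗ ρ′ → ⟦ belowFm p r X ⟧ σ ρ ⇔ Below p (ρ X) σ ρ′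
  ⟦belowFm⟧ {φ = `∀ ψ} (πΣ _) r X hr = ∀-cong-⇔ λ w →
    →-cong-⇔ (⇔-id _) (⟦rename⟧ id (lift 1 r) ψ (λ _ → refl) (lift-≗ w hr))
  ⟦belowFm⟧ (πΠ p) r X hr = ∀-cong-⇔ λ w →
    →-cong-⇔ (⇔-id _) (⟦belowFm⟧ p (lift 1 r) (suc X) (lift-≗ w hr))

  ⟦codedFm⟧ : ∀ {k n N} {φ : Fm k n} (q : IsΣ 2 φ) (r : Fin n → Fin N) (C : Tm N) (c X : Fin N)
              {σ : Vector 𝓢 k} {ρ : Vector M N} {ρ′ : Vector M n} →
              ρ ∘ r ≗ ρ′ → ⟦ codedFm q r C c X ⟧ σ ρ ⇔ Coded q (⟦ C ⟧t ρ) (ρ c) (ρ X) σ ρ′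
  ⟦codedFm⟧ (σΠ p) r C c X hr = ∃-cong-⇔ λ u →
    ≡⇒⇔ (cong (λ C′ → _ ≡ pair C′ u) (⟦weakenTm⟧ C)) ×-⇔ ⟦belowFm⟧ p (lift 1 r) (suc X) (lift-≗ u hr)
  ⟦codedFm⟧ (σΣ q) r C c X hr = ∃-cong-⇔ λ u →
    ≡⇒⇔ (cong (λ C′ → Coded q (pair C′ u) _ _ _ _) (⟦weakenTm⟧ C)) ⇔-∘
    ⟦codedFm⟧ q (lift 1 r) (pairTm (weakenTm C) v₀) (suc c) (suc X) (lift-≗ u hr)

  Σ⁰₂⇒witnessing : ∀ {B} → IsΣ⁰Set 2 B → Σ⁰₂Witnessing 𝓜 B
  Σ⁰₂⇒witnessing (k , β , β-Σ₂ , σ , B⇔β) = record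
    { Witness = λ e c X → Coded β-Σ₂ e c X σ (e ∷ [])
    ; Witness-Σ⁰₁ = k , codedFm β-Σ₂ (λ _ → zero) v₀ (suc zero) (suc (suc zero)) ,
                    codedFm-Σ₁ β-Σ₂ _ _ _ _ , σ ,
                    λ ρ → ⇔-sym (⟦codedFm⟧ β-Σ₂ _ _ _ _ λ { zero → refl })
    ; witness-exists = λ Be → ⟦⟧⇒Coded β-Σ₂ (to (B⇔β _) Be) _
    ; witness-determines = Coded-injective β-Σ₂
    ; witness-sound = λ H → from (B⇔β _) (Coded⇒⟦⟧ β-Σ₂ H)
    }

open Structure using (M)
open Semantics using (IsRCA₀; IΣ⁰₂; IsΣ⁰₁PartialFunction; IsΣ⁰Set; WeaklyRepresented; RestrictedFamily)

mainTheorem4 : ExcludedMiddle 0ℓ →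
    (𝓜 : Structure) → IsRCA₀ 𝓜 → IΣ⁰₂ 𝓜 →
    (Ψ : M 𝓜 → M 𝓜 → M 𝓜 → Set) → IsΣ⁰₁PartialFunction 𝓜 Ψ →
    (B : M 𝓜 → Set) → IsΣ⁰Set 𝓜 2 B →
    WeaklyRepresented 𝓜 (RestrictedFamily 𝓜 Ψ B)
mainTheorem4 _ 𝓜 rca _ Ψ Ψ-partial B B-Σ⁰₂ =
  Representation.restrictedFamily-weaklyRepresented 𝓜 Ψ-partial (Truncation.Σ⁰₂⇒witnessing 𝓜 rca B-Σ⁰₂)
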